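{- Let $q$ be a prime power, $n\ge1$, $d_1,d_2\ge1$, $c:=\gcd(d_1,d_2)$, and for $m\ge1$ let $M_m:=(q^{d_1m}-1)/(q^{cm}-1)$. Then the sequence $\{\gcd(n,M_m)\}_{m=1}^\infty$ is periodic with period $\varphi(n)$, i.e. $\gcd(n,M_{m+\varphi(n)})=\gcd(n,M_m)$ for all $m\ge1$.
   Context: $\varphi$ denotes Euler's totient function. -}

module Defs where

open import Data.Nat using (ℕ; zero; suc; _+_; _*_; _∸_; _^_; _/_)
open import Data.Nat.GCD using (gcd)
open import Data.Nat.Primality using (Prime)
open import Data.List using (length; filter; upTo)
open import Data.Nat.Coprimality using (coprime?)
open import Data.Product using (∃₂; _×_)
open import Relation.Binary.PropositionalEquality using (_≡_)
open import Data.Nat using (_≥_)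

-- Euler's totient: φ n = #{ k ∈ {1,…,n} : gcd(k,n) = 1 }.
-- (upTo n = [0,…,n-1]; we shift by 1 to range over 1..n.)
φ : ℕ → ℕ
φ n = length (filter (λ k → coprime? (suc k) n) (upTo n))

IsPrimePower : ℕ → Set
IsPrimePower q = ∃₂ λ p k → Prime p × k ≥ 1 × q ≡ p ^ k

-- Natural-number division a / b, returning 0 when b = 0
-- (the b = 0 case never occurs under the lemma's hypotheses).
_÷_ : ℕ → ℕ → ℕ
a ÷ zero    = 0
a ÷ suc b   = a / suc b

M : (q d₁ d₂ m : ℕ) → ℕ
M q d₁ d₂ m = (q ^ (d₁ * m) ∸ 1) ÷ (q ^ (gcd d₁ d₂ * m) ∸ 1)

{-# OPTIONS --safe #-}
-- Write q = p ^ k and c = gcd d₁ d₂, so that d₁ = e c and M_m = 1 + Q + ⋯ + Q ^ (e - 1) with Q = q ^ (c m).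
-- Since M_m ≡ 1 mod p, only the p-free part n′ of n = p ^ b n′ matters: gcd n M_m = gcd n′ M_m.
-- The number n′ + q is a unit modulo n and is congruent to q modulo n′, so Euler's theorem for n gives
-- q ^ φ n ≡ 1 mod n′. Hence Q, and with it M_m, is periodic in m modulo n′ with period φ n.
module Submission where

open import Defs
open import Data.Nat using (ℕ; _+_; _≥_)
open import Data.Nat.GCD using (gcd)
open import Relation.Binary.PropositionalEquality using (_≡_)

open import Data.Empty using (⊥-elim)
open import Data.List using (List; []; _∷_; _++_; length; map; filter; upTo)
open import Data.List.Properties using (length-++; length-map)
open import Data.List.Membership.Propositional using (_∈_)
open import Data.List.Membership.Propositional.Properties
  using (∈-∃++; ∈-++⁻; ∈-++⁺ˡ; ∈-++⁺ʳ; ∈-map⁻; ∈-map⁺; ∈-filter⁻; ∈-filter⁺; ∈-upTo⁻; ∈-upTo⁺)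
open import Data.List.Relation.Binary.Subset.Propositional using (_⊆_)
open import Data.List.Relation.Binary.Permutation.Propositional using (_↭_; ↭-refl; ↭-trans; ↭-sym; ↭-prep)
open import Data.List.Relation.Binary.Permutation.Propositional.Properties using (shift)
open import Data.List.Relation.Unary.All as All using (All; []; _∷_)
import Data.List.Relation.Unary.All.Properties as All
open import Data.List.Relation.Unary.Any using (here; there)
open import Data.List.Relation.Unary.AllPairs using ([]; _∷_)
open import Data.List.Relation.Unary.Unique.Propositional using (Unique)
import Data.List.Relation.Unary.Unique.Propositional.Properties as Unique
open import Data.Nat.Base
open import Data.Nat.Coprimality as Coprime using (Coprime; coprime?; coprime-divisor; coprime-+; 1-coprimeTo; ¬0-coprimeTo-2+)
open import Data.Nat.DivMod
open import Data.Nat.Divisibility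
open import Data.Nat.GCD using (gcd[m,n]∣m; gcd[m,n]∣n; gcd[m,n]≢0; gcd-greatest)
open import Data.Nat.Induction using (<-wellFounded)
open import Data.Nat.ListAction using (product)
open import Data.Nat.ListAction.Properties using (product-↭)
open import Data.Nat.Primality using (Prime; prime⇒irreducible; prime⇒nonTrivial; prime⇒nonZero)
open import Data.Nat.Properties
open import Algebra.Properties.CommutativeSemigroup *-commutativeSemigroup using () renaming (interchange to *-interchange)
open import Data.Nat.Tactic.RingSolver using (solve-∀)
open import Data.Product using (∃₂; _×_; _,_; proj₁; proj₂)
open import Data.Sum using (inj₁; inj₂; [_,_]′)
open import Induction.WellFounded using (Acc; acc)
open import Level using (Level)
open import Relation.Binary.PropositionalEquality using (refl; sym; trans; cong; cong₂; subst; subst₂; module ≡-Reasoning)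
open import Relation.Nullary using (¬_; yes; no; contradiction)

private
  variable
    ℓ ℓ′ : Level
    A : Set ℓ
    B : Set ℓ′

⊆∧length≡⇒↭ : {xs ys : List A} → Unique xs → xs ⊆ ys → length xs ≡ length ys → xs ↭ ys
⊆∧length≡⇒↭ {xs = []} {[]} _ _ _ = ↭-refl
⊆∧length≡⇒↭ {xs = x ∷ xs} (x∉xs ∷ xs!) xs⊆ys |xs|≡|ys|
  with as , bs , refl ← ∈-∃++ (xs⊆ys (here refl)) =
  ↭-trans (↭-prep x (⊆∧length≡⇒↭ xs! xs⊆as++bs |xs|≡|as++bs|)) (↭-sym (shift x as bs))
  where
  xs⊆as++bs : xs ⊆ as ++ bs
  xs⊆as++bs {y} y∈xs with ∈-++⁻ as (xs⊆ys (there y∈xs))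
  ... | inj₁ y∈as        = ∈-++⁺ˡ y∈as
  ... | inj₂ (here refl) = contradiction refl (All.lookup x∉xs y∈xs)
  ... | inj₂ (there y∈bs) = ∈-++⁺ʳ as y∈bs
  |xs|≡|as++bs| : length xs ≡ length (as ++ bs)
  |xs|≡|as++bs| = suc-injective (begin
    suc (length xs)             ≡⟨ |xs|≡|ys| ⟩
    length (as ++ x ∷ bs)       ≡⟨ length-++ as ⟩
    length as + suc (length bs) ≡⟨ +-suc (length as) _ ⟩
    suc (length as + length bs) ≡⟨ cong suc (length-++ as) ⟨
    suc (length (as ++ bs))     ∎)
    where open ≡-Reasoning

Unique-map⁺ : {P : A → Set ℓ} {f : A → B} → (∀ {x y} → P x → P y → f x ≡ f y → x ≡ y) →
              {xs : List A} → All P xs → Unique xs → Unique (map f xs)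
Unique-map⁺ inj [] [] = []
Unique-map⁺ inj (px ∷ pxs) (x∉xs ∷ xs!) =
  All.map⁺ (All.zipWith (λ (x≢y , py) fx≡fy → x≢y (inj px py fx≡fy)) (x∉xs , pxs))
  ∷ Unique-map⁺ inj pxs xs!

%≡%⇒∣∸ : ∀ {x y n} .{{_ : NonZero n}} → x % n ≡ y % n → n ∣ x ∸ y
%≡%⇒∣∸ {x} {y} {n} eq = divides (x / n ∸ y / n) (begin
  x ∸ y                                     ≡⟨ cong₂ _∸_ (m≡m%n+[m/n]*n x n) (m≡m%n+[m/n]*n y n) ⟩
  (x % n + x / n * n) ∸ (y % n + y / n * n) ≡⟨ cong (λ r → (r + x / n * n) ∸ (y % n + y / n * n)) eq ⟩
  (y % n + x / n * n) ∸ (y % n + y / n * n) ≡⟨ [m+n]∸[m+o]≡n∸o (y % n) _ _ ⟩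
  x / n * n ∸ y / n * n                     ≡⟨ *-distribʳ-∸ n (x / n) (y / n) ⟨
  (x / n ∸ y / n) * n                       ∎)
  where open ≡-Reasoning

∣∸⇒%≡% : ∀ {x y n} .{{_ : NonZero n}} → y ≤ x → n ∣ x ∸ y → x % n ≡ y % n
∣∸⇒%≡% {x} {y} {n} y≤x n∣x∸y = begin
  x % n             ≡⟨ cong (_% n) (m+[n∸m]≡n y≤x) ⟨
  (y + (x ∸ y)) % n ≡⟨ %-remove-+ʳ y n∣x∸y ⟩
  y % n             ∎
  where open ≡-Reasoning

%-cong-+ : ∀ {x y u v n} .{{_ : NonZero n}} → x % n ≡ y % n → u % n ≡ v % n → (x + u) % n ≡ (y + v) % n
%-cong-+ {x} {y} {u} {v} {n} x≡y u≡v = begin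
  (x + u) % n           ≡⟨ %-distribˡ-+ x u n ⟩
  (x % n + u % n) % n   ≡⟨ cong₂ (λ r s → (r + s) % n) x≡y u≡v ⟩
  (y % n + v % n) % n   ≡⟨ %-distribˡ-+ y v n ⟨
  (y + v) % n           ∎
  where open ≡-Reasoning

%-cong-* : ∀ {x y u v n} .{{_ : NonZero n}} → x % n ≡ y % n → u % n ≡ v % n → (x * u) % n ≡ (y * v) % n
%-cong-* {x} {y} {u} {v} {n} x≡y u≡v = begin
  (x * u) % n           ≡⟨ %-distribˡ-* x u n ⟩
  (x % n * (u % n)) % n ≡⟨ cong₂ (λ r s → (r * s) % n) x≡y u≡v ⟩
  (y % n * (v % n)) % n ≡⟨ %-distribˡ-* y v n ⟨
  (y * v) % n           ∎
  where open ≡-Reasoning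

%-cong-^ : ∀ {x y n} .{{_ : NonZero n}} k → x % n ≡ y % n → (x ^ k) % n ≡ (y ^ k) % n
%-cong-^ zero    x≡y = refl
%-cong-^ (suc k) x≡y = %-cong-* x≡y (%-cong-^ k x≡y)

%-cancelʳ-* : ∀ {a x y n} .{{_ : NonZero n}} → Coprime n a → (x * a) % n ≡ (y * a) % n → x % n ≡ y % n
%-cancelʳ-* {a} {n = n} n⊥a xa≡ya =
  [ (λ y≤x → cancel y≤x xa≡ya) , (λ x≤y → sym (cancel x≤y (sym xa≡ya))) ]′ (≤-total _ _)
  where
  cancel : ∀ {x y} → y ≤ x → (x * a) % n ≡ (y * a) % n → x % n ≡ y % n
  cancel {x} {y} y≤x xa≡ya = ∣∸⇒%≡% y≤x (coprime-divisor n⊥a n∣a*[x∸y])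
    where
    n∣a*[x∸y] : n ∣ a * (x ∸ y)
    n∣a*[x∸y] = subst (n ∣_) (trans (sym (*-distribʳ-∸ a x y)) (*-comm (x ∸ y) a)) (%≡%⇒∣∸ xa≡ya)

coprime-* : ∀ {x y n} → Coprime x n → Coprime y n → Coprime (x * y) n
coprime-* {x} {y} {n} x⊥n y⊥n {d} (d∣xy , d∣n) = y⊥n (coprime-divisor d⊥x d∣xy , d∣n)
  where
  d⊥x : Coprime d x
  d⊥x (e∣d , e∣x) = x⊥n (e∣x , ∣-trans e∣d d∣n)

m∣m^n : ∀ m n .{{_ : NonZero n}} → m ∣ m ^ n
m∣m^n m (suc n) = m∣m*n (m ^ n)

coprime-^ : ∀ {x n} k → Coprime x n → Coprime (x ^ k) n
coprime-^ {n = n} zero    x⊥n = 1-coprimeTo n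
coprime-^         (suc k) x⊥n = coprime-* x⊥n (coprime-^ k x⊥n)

coprime-product : ∀ {xs n} → All (λ x → Coprime x n) xs → Coprime (product xs) n
coprime-product {n = n} []            = 1-coprimeTo n
coprime-product         (x⊥n ∷ xs⊥n) = coprime-* x⊥n (coprime-product xs⊥n)

prime∧∤⇒coprime : ∀ {p x} → Prime p → ¬ p ∣ x → Coprime p x
prime∧∤⇒coprime p-prime p∤x (d∣p , d∣x) with prime⇒irreducible p-prime d∣p
... | inj₁ d≡1  = d≡1
... | inj₂ refl = contradiction d∣x p∤x

gcd-cong-% : ∀ {x y n} .{{_ : NonZero n}} → x % n ≡ y % n → gcd n x ≡ gcd n y
gcd-cong-% x≡y = ∣-antisym (gcd∣gcd x≡y) (gcd∣gcd (sym x≡y))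
  where
  gcd∣gcd : ∀ {x y n} .{{_ : NonZero n}} → x % n ≡ y % n → gcd n x ∣ gcd n y
  gcd∣gcd {x} {y} {n} x≡y = gcd-greatest g∣n (∣n∣m%n⇒∣m g∣n (subst (g ∣_) x≡y (%-presˡ-∣ (gcd[m,n]∣n n x) g∣n)))
    where
    g = gcd n x
    g∣n = gcd[m,n]∣m n x

coprime⇒gcd[m*n,o]≡gcd[n,o] : ∀ {m n o} → Coprime m o → gcd (m * n) o ≡ gcd n o
coprime⇒gcd[m*n,o]≡gcd[n,o] {m} {n} {o} m⊥o = ∣-antisym
  (gcd-greatest (coprime-divisor g⊥m (gcd[m,n]∣m (m * n) o)) (gcd[m,n]∣n (m * n) o))
  (gcd-greatest (∣-trans (gcd[m,n]∣m n o) (n∣m*n m)) (gcd[m,n]∣n n o))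
  where
  g⊥m : Coprime (gcd (m * n) o) m
  g⊥m (d∣g , d∣m) = m⊥o (d∣m , ∣-trans d∣g (gcd[m,n]∣n (m * n) o))

units : ℕ → List ℕ
units n = map suc (filter (λ k → coprime? (suc k) n) (upTo n))

length-units : ∀ n → length (units n) ≡ φ n
length-units n = length-map suc (filter (λ k → coprime? (suc k) n) (upTo n))

module Euler (n : ℕ) .{{_ : NonTrivial n}} where

  private instance
    n≢0 : NonZero n
    n≢0 = nonTrivial⇒nonZero n

  ∈-units⁻ : ∀ {x} → x ∈ units n → x < n × Coprime x n
  ∈-units⁻ x∈ with k , k∈ , refl ← ∈-map⁻ suc x∈
               with k<n , 1+k⊥n ← ∈-filter⁻ (λ k → coprime? (suc k) n) {xs = upTo n} k∈
    = 1+k<n , 1+k⊥n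
    where
    1+k<n : suc k < n
    1+k<n with m≤n⇒m<n∨m≡n (∈-upTo⁻ k<n)
    ... | inj₁ 1+k<n = 1+k<n
    ... | inj₂ refl  = contradiction (1+k⊥n (∣-refl , ∣-refl)) (nonTrivial⇒≢1 {n})

  ∈-units⁺ : ∀ {x} → x < n → Coprime x n → x ∈ units n
  ∈-units⁺ {zero}  _   0⊥n = ⊥-elim (¬0-coprimeTo-2+ {n} 0⊥n)
  ∈-units⁺ {suc k} x<n x⊥n =
    ∈-map⁺ suc (∈-filter⁺ (λ k → coprime? (suc k) n) (∈-upTo⁺ (<-trans (n<1+n k) x<n)) x⊥n)

  module _ {a} (a⊥n : Coprime a n) where

    times-a : ℕ → ℕ
    times-a x = a * x % n

    times-a-units-↭ : map times-a (units n) ↭ units n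
    times-a-units-↭ = ⊆∧length≡⇒↭ unique image⊆units (length-map times-a (units n))
      where
      units-< : All (_< n) (units n)
      units-< = All.tabulate (λ x∈ → proj₁ (∈-units⁻ x∈))
      times-a-injective : ∀ {x y} → x < n → y < n → times-a x ≡ times-a y → x ≡ y
      times-a-injective {x} {y} x<n y<n ax≡ay = begin
        x     ≡⟨ m<n⇒m%n≡m x<n ⟨
        x % n ≡⟨ %-cancelʳ-* (Coprime.sym a⊥n) (subst₂ (λ u v → u % n ≡ v % n) (*-comm a x) (*-comm a y) ax≡ay) ⟩
        y % n ≡⟨ m<n⇒m%n≡m y<n ⟩
        y     ∎
        where open ≡-Reasoning
      unique : Unique (map times-a (units n))
      unique = Unique-map⁺ times-a-injective units-<
        (Unique.map⁺ suc-injective (Unique.filter⁺ (λ k → coprime? (suc k) n) (Unique.upTo⁺ n)))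
      image⊆units : map times-a (units n) ⊆ units n
      image⊆units y∈ with x , x∈ , refl ← ∈-map⁻ times-a y∈ =
        ∈-units⁺ (m%n<n (a * x) n) (λ (d∣ax%n , d∣n) →
          coprime-* a⊥n (proj₂ (∈-units⁻ x∈)) (∣n∣m%n⇒∣m d∣n d∣ax%n , d∣n))

    product-map-times-a : ∀ xs → product (map times-a xs) % n ≡ (a ^ length xs * product xs) % n
    product-map-times-a []       = refl
    product-map-times-a (x ∷ xs) = begin
      (times-a x * product (map times-a xs)) % n ≡⟨ %-cong-* {n = n} (m%n%n≡m%n (a * x) n) (product-map-times-a xs) ⟩
      (a * x * (a ^ length xs * product xs)) % n ≡⟨ cong (_% n) (*-interchange a x (a ^ length xs) (product xs)) ⟩
      (a * a ^ length xs * (x * product xs)) % n ∎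
      where open ≡-Reasoning

    euler : a ^ φ n % n ≡ 1 % n
    euler = %-cancelʳ-* (Coprime.sym (coprime-product (All.tabulate (λ x∈ → proj₂ (∈-units⁻ x∈))))) (begin
      (a ^ φ n * P) % n                   ≡⟨ cong (λ l → (a ^ l * P) % n) (length-units n) ⟨
      (a ^ length (units n) * P) % n      ≡⟨ product-map-times-a (units n) ⟨
      product (map times-a (units n)) % n ≡⟨ cong (_% n) (product-↭ times-a-units-↭) ⟩
      P % n                               ≡⟨ cong (_% n) (*-identityˡ P) ⟨
      (1 * P) % n                         ∎)
      where
      open ≡-Reasoning
      P = product (units n)

euler : ∀ {a n} .{{_ : NonZero n}} → Coprime a n → a ^ φ n % n ≡ 1 % n
euler {a} {1}          _   = trans (n%1≡0 (a ^ φ 1)) (sym (n%1≡0 1))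
euler {n = 2+ _} a⊥n = Euler.euler _ a⊥n

p-part : ∀ {p} → 1 < p → ∀ n .{{_ : NonZero n}} → ∃₂ λ b m → n ≡ p ^ b * m × ¬ p ∣ m
p-part {p} 1<p n = go n (<-wellFounded n)
  where
  go : ∀ n .{{_ : NonZero n}} → Acc _<_ n → ∃₂ λ b m → n ≡ p ^ b * m × ¬ p ∣ m
  go n (acc rec) with p ∣? n
  ... | no  p∤n = 0 , n , sym (+-identityʳ n) , p∤n
  ... | yes (divides zero n≡0) = contradiction n≡0 (≢-nonZero⁻¹ n)
  ... | yes (divides t@(suc _) n≡t*p)
    with b , m , t≡p^b*m , p∤m ← go t (rec (subst (t <_) (sym n≡t*p) (m<m*n t p 1<p))) =
    suc b , m , (begin
      n               ≡⟨ n≡t*p ⟩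
      t * p           ≡⟨ cong (_* p) t≡p^b*m ⟩
      p ^ b * m * p   ≡⟨ *-comm (p ^ b * m) p ⟩
      p * (p ^ b * m) ≡⟨ *-assoc p (p ^ b) m ⟨
      p * p ^ b * m   ∎) , p∤m
    where open ≡-Reasoning

euler-∣ : ∀ {a d n} .{{_ : NonZero d}} .{{_ : NonZero n}} → d ∣ n → Coprime (d + a) n → a ^ φ n % d ≡ 1 % d
euler-∣ {a} {d} {n} d∣n d+a⊥n = begin
  a ^ φ n % d           ≡⟨ %-cong-^ (φ n) (%-remove-+ˡ a (∣-refl {d})) ⟨
  (d + a) ^ φ n % d     ≡⟨ m∣n⇒o%n%m≡o%m d n ((d + a) ^ φ n) d∣n ⟨
  (d + a) ^ φ n % n % d ≡⟨ cong (_% d) (euler d+a⊥n) ⟩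
  1 % n % d             ≡⟨ m∣n⇒o%n%m≡o%m d n 1 d∣n ⟩
  1 % d                 ∎
  where open ≡-Reasoning

prime-power^φ≡1 : ∀ {p d} k b → Prime p → ¬ p ∣ d → .{{_ : NonZero k}} .{{_ : NonZero d}} →
                  (p ^ k) ^ φ (p ^ b * d) % d ≡ 1 % d
prime-power^φ≡1 {p} {d} k b p-prime p∤d =
  euler-∣ (n∣m*n (p ^ b)) (Coprime.sym (coprime-* (Coprime.sym [d+p^k]⊥p^b) (Coprime.sym [d+p^k]⊥d)))
  where
  instance
    _ : NonZero (p ^ b * d)
    _ = m*n≢0 (p ^ b) d {{m^n≢0 p b {{prime⇒nonZero p-prime}}}}
  p∤d+p^k : ¬ p ∣ d + p ^ k
  p∤d+p^k p∣d+p^k = p∤d (∣m+n∣m⇒∣n (subst (p ∣_) (+-comm d (p ^ k)) p∣d+p^k) (m∣m^n p k))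
  [d+p^k]⊥p^b : Coprime (d + p ^ k) (p ^ b)
  [d+p^k]⊥p^b = Coprime.sym (coprime-^ b (prime∧∤⇒coprime p-prime p∤d+p^k))
  [d+p^k]⊥d : Coprime (d + p ^ k) d
  [d+p^k]⊥d = coprime-+ (coprime-^ k (prime∧∤⇒coprime p-prime p∤d))

a^t%n≡1⇒a^[c*[s+t]]%n≡a^[c*s]%n : ∀ {a t n} .{{_ : NonZero n}} c s →
                                  a ^ t % n ≡ 1 % n → a ^ (c * (s + t)) % n ≡ a ^ (c * s) % n
a^t%n≡1⇒a^[c*[s+t]]%n≡a^[c*s]%n {a} {t} {n} c s a^t≡1 = begin
  a ^ (c * (s + t)) % n         ≡⟨ cong (λ x → a ^ x % n) (trans (*-distribˡ-+ c s t) (cong (c * s +_) (*-comm c t))) ⟩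
  a ^ (c * s + t * c) % n       ≡⟨ cong (_% n) (^-distribˡ-+-* a (c * s) (t * c)) ⟩
  a ^ (c * s) * a ^ (t * c) % n ≡⟨ cong (λ x → a ^ (c * s) * x % n) (^-*-assoc a t c) ⟨
  a ^ (c * s) * (a ^ t) ^ c % n ≡⟨ %-cong-* {a ^ (c * s)} {n = n} refl (%-cong-^ c a^t≡1) ⟩
  a ^ (c * s) * 1 ^ c % n       ≡⟨ cong (λ x → a ^ (c * s) * x % n) (^-zeroˡ c) ⟩
  a ^ (c * s) * 1 % n           ≡⟨ cong (_% n) (*-identityʳ (a ^ (c * s))) ⟩
  a ^ (c * s) % n               ∎
  where open ≡-Reasoning

geometric : ℕ → ℕ → ℕ
geometric x zero    = 0
geometric x (suc k) = 1 + x * geometric x k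

*-geometric+1≡^ : ∀ y k → y * geometric (suc y) k + 1 ≡ suc y ^ k
*-geometric+1≡^ y zero    = cong (_+ 1) (*-zeroʳ y)
*-geometric+1≡^ y (suc k) = begin
  y * (1 + suc y * g) + 1 ≡⟨ identity y g ⟩
  suc y * (y * g + 1)     ≡⟨ cong (suc y *_) (*-geometric+1≡^ y k) ⟩
  suc y * suc y ^ k       ∎
  where
  open ≡-Reasoning
  g = geometric (suc y) k
  identity : ∀ y g → y * (1 + suc y * g) + 1 ≡ suc y * (y * g + 1)
  identity = solve-∀

[^∸1]÷[∸1]≡geometric : ∀ {x} k → 1 < x → (x ^ k ∸ 1) ÷ (x ∸ 1) ≡ geometric x k
[^∸1]÷[∸1]≡geometric {1} k (s≤s ())
[^∸1]÷[∸1]≡geometric {x@(suc y@(suc _))} k _ = begin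
  (x ^ k ∸ 1) / y     ≡⟨ cong (λ z → (z ∸ 1) / y) (*-geometric+1≡^ y k) ⟨
  (y * g + 1 ∸ 1) / y ≡⟨ cong (_/ y) (m+n∸n≡m (y * g) 1) ⟩
  (y * g) / y         ≡⟨ cong (_/ y) (*-comm y g) ⟩
  (g * y) / y         ≡⟨ m*n/n≡m g y ⟩
  g                   ∎
  where
  open ≡-Reasoning
  g = geometric x k

geometric-cong-% : ∀ {x y n} .{{_ : NonZero n}} k → x % n ≡ y % n → geometric x k % n ≡ geometric y k % n
geometric-cong-%         zero    x≡y = refl
geometric-cong-% {n = n} (suc k) x≡y = %-cong-+ {1} {1} {n = n} refl (%-cong-* x≡y (geometric-cong-% k x≡y))

∣⇒coprime-geometric : ∀ {d x} k .{{_ : NonZero k}} → d ∣ x → Coprime d (geometric x k)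
∣⇒coprime-geometric {x = x} (suc k) d∣x {e} (e∣d , e∣1+xg) =
  ∣1⇒≡1 (∣m+n∣m⇒∣n (subst (e ∣_) (+-comm 1 _) e∣1+xg) (∣-trans e∣d (∣m⇒∣m*n (geometric x k) d∣x)))

M≡geometric : ∀ {q d₁ d₂} e m → 1 < q → d₁ ≡ e * gcd d₁ d₂ → 0 < gcd d₁ d₂ * m →
              M q d₁ d₂ m ≡ geometric (q ^ (gcd d₁ d₂ * m)) e
M≡geometric {q} {d₁} {d₂} e m 1<q d₁≡e*c 0<c*m = begin
  (q ^ (d₁ * m) ∸ 1) ÷ (q ^ (c * m) ∸ 1)      ≡⟨ cong (λ z → (z ∸ 1) ÷ (q ^ (c * m) ∸ 1)) q^[d₁*m]≡[q^[c*m]]^e ⟩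
  ((q ^ (c * m)) ^ e ∸ 1) ÷ (q ^ (c * m) ∸ 1) ≡⟨ [^∸1]÷[∸1]≡geometric e (^-monoʳ-< q 1<q 0<c*m) ⟩
  geometric (q ^ (c * m)) e                   ∎
  where
  open ≡-Reasoning
  c = gcd d₁ d₂
  q^[d₁*m]≡[q^[c*m]]^e : q ^ (d₁ * m) ≡ (q ^ (c * m)) ^ e
  q^[d₁*m]≡[q^[c*m]]^e = begin
    q ^ (d₁ * m)      ≡⟨ cong (λ z → q ^ (z * m)) d₁≡e*c ⟩
    q ^ (e * c * m)   ≡⟨ cong (q ^_) (trans (*-assoc e c m) (*-comm e (c * m))) ⟩
    q ^ (c * m * e)   ≡⟨ ^-*-assoc q (c * m) e ⟨
    (q ^ (c * m)) ^ e ∎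

gcd-M≡gcd-geometric : ∀ {p k n n′ d₁ d₂} b e m → Prime p → n ≡ p ^ b * n′ → d₁ ≡ e * gcd d₁ d₂ →
                      .{{_ : NonZero k}} .{{_ : NonZero d₁}} .{{_ : NonZero m}} →
                      gcd n (M (p ^ k) d₁ d₂ m) ≡ gcd n′ (geometric ((p ^ k) ^ (gcd d₁ d₂ * m)) e)
gcd-M≡gcd-geometric {p} {k} {n} {n′} {d₁} {d₂} b e m p-prime n≡p^b*n′ d₁≡e*c = begin
  gcd n (M q d₁ d₂ m)  ≡⟨ cong (gcd n) (M≡geometric e m 1<q d₁≡e*c (>-nonZero⁻¹ (c * m))) ⟩
  gcd n G              ≡⟨ cong (λ x → gcd x G) n≡p^b*n′ ⟩
  gcd (p ^ b * n′) G   ≡⟨ coprime⇒gcd[m*n,o]≡gcd[n,o] (coprime-^ b p⊥G) ⟩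
  gcd n′ G             ∎
  where
  open ≡-Reasoning
  q = p ^ k
  c = gcd d₁ d₂
  G = geometric (q ^ (c * m)) e
  instance
    _ : NonZero (c * m)
    _ = m*n≢0 c m {{≢-nonZero (gcd[m,n]≢0 d₁ d₂ (inj₁ (≢-nonZero⁻¹ d₁)))}}
    _ : NonZero e
    _ = ≢-nonZero λ { refl → ≢-nonZero⁻¹ d₁ d₁≡e*c }
  1<q : 1 < q
  1<q = ^-monoʳ-< p (nonTrivial⇒n>1 p {{prime⇒nonTrivial p-prime}}) (>-nonZero⁻¹ k)
  p⊥G : Coprime p G
  p⊥G = ∣⇒coprime-geometric e (∣-trans (m∣m^n p k) (m∣m^n q (c * m)))

lemma2p7 : (q n d₁ d₂ : ℕ) → IsPrimePower q → n ≥ 1 → d₁ ≥ 1 → d₂ ≥ 1 →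
    (m : ℕ) → m ≥ 1 →
    gcd n (M q d₁ d₂ (m + φ n)) ≡ gcd n (M q d₁ d₂ m)
lemma2p7 .(p ^ k) n@(suc _) d₁ d₂ (p , k , p-prime , k≥1 , refl) _ d₁≥1 _ m m≥1
  with b , n′ , n≡p^b*n′ , p∤n′ ← p-part (nonTrivial⇒n>1 p {{prime⇒nonTrivial p-prime}}) n
     | divides e d₁≡e*c ← gcd[m,n]∣m d₁ d₂ = begin
  gcd n (M q d₁ d₂ (m + φ n))                ≡⟨ gcd-M≡gcd-geometric b e (m + φ n) p-prime n≡p^b*n′ d₁≡e*c ⟩
  gcd n′ (geometric (q ^ (c * (m + φ n))) e) ≡⟨ gcd-cong-% {n = n′} (geometric-cong-% e q^[c*[m+φn]]≡q^[c*m]) ⟩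
  gcd n′ (geometric (q ^ (c * m)) e)         ≡⟨ gcd-M≡gcd-geometric b e m p-prime n≡p^b*n′ d₁≡e*c ⟨
  gcd n (M q d₁ d₂ m)                        ∎
  where
  open ≡-Reasoning
  q = p ^ k
  c = gcd d₁ d₂
  instance
    _ : NonZero n′
    _ = ≢-nonZero λ { refl → p∤n′ (p ∣0) }
    _ : NonZero k
    _ = >-nonZero k≥1
    _ : NonZero d₁
    _ = >-nonZero d₁≥1
    _ : NonZero m
    _ = >-nonZero m≥1
    _ : NonZero (m + φ n)
    _ = >-nonZero (≤-trans m≥1 (m≤m+n m (φ n)))
  q^φn%n′≡1 : q ^ φ n % n′ ≡ 1 % n′
  q^φn%n′≡1 = subst (λ x → q ^ φ x % n′ ≡ 1 % n′) (sym n≡p^b*n′) (prime-power^φ≡1 k b p-prime p∤n′)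
  q^[c*[m+φn]]≡q^[c*m] : q ^ (c * (m + φ n)) % n′ ≡ q ^ (c * m) % n′
  q^[c*[m+φn]]≡q^[c*m] = a^t%n≡1⇒a^[c*[s+t]]%n≡a^[c*s]%n c m q^φn%n′≡1
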